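{- Let $H$ be a finite digraph. If $H$ contains a symmetrically invertible pair, then $H$ does not admit a Min-Max ordering.
   Context: A linear ordering $<$ of $V(H)$ is a Min-Max ordering if for all vertices $i,j,s,r$: $i<j$, $s<r$ and $ir, js \in A(H)$ imply $is,jr \in A(H)$. A walk $x_0,\dots,x_n$ is a sequence of vertices where each $x_ix_{i+1}$ is either a forward arc ($x_ix_{i+1}\in A(H)$) or a backward arc ($x_{i+1}x_i\in A(H)$), with a designated choice. Walks $P=x_0,\dots,x_n$, $Q=y_0,\dots,y_n$ are congruent if $x_ix_{i+1}$ is forward iff $y_iy_{i+1}$ is forward, for all $i$. For congruent $P,Q$, $x_iy_{i+1}$ is a faithful arc from $P$ to $Q$ if it is a forward (resp. backward) arc when $x_ix_{i+1}$ is forward (resp. backward), and $y_ix_{i+1}$ is a faithful arc from $Q$ to $P$ if it is forward (resp. backward) when $x_ix_{i+1}$ is forward (resp. backward). $P,Q$ avoid each other if for no $i\in\{0,\dots,n-1\}$ are both $x_iy_{i+1}$ and $y_ix_{i+1}$ faithful arcs. A symmetrically invertible pair is a pair of distinct vertices $u,v$ with congruent walks $P$ from $u$ to $v$ and $Q$ from $v$ to $u$ that avoid each other. -}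

module Defs where

open import Data.Nat using (ℕ; suc)
open import Data.Fin using (Fin; inject₁) renaming (suc to fsuc)
open import Data.Bool using (Bool; true; false)
open import Data.Product using (Σ; ∃; _×_; _,_)
open import Relation.Nullary using (¬_)
open import Relation.Binary.PropositionalEquality using (_≡_)
open import Relation.Binary.Structures using (IsStrictTotalOrder)

record Digraph : Set₁ where
  field
    size : ℕ
    Arc  : Fin size → Fin size → Set

open Digraph public

Vertex : Digraph → Set
Vertex H = Fin (size H)

DirArc : (H : Digraph) → Bool → Vertex H → Vertex H → Set
DirArc H true  x y = Arc H x y
DirArc H false x y = Arc H y x

IsMinMaxOrdering : (H : Digraph) → (Vertex H → Vertex H → Set) → Set
IsMinMaxOrdering H _<_ =
  IsStrictTotalOrder _≡_ _<_ ×
  (∀ i j s r → i < j → s < r → Arc H i r → Arc H j s → Arc H i s × Arc H j r)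

AdmitsMinMaxOrdering : Digraph → Set₁
AdmitsMinMaxOrdering H = Σ (Vertex H → Vertex H → Set) (IsMinMaxOrdering H)

record Walk (H : Digraph) (m : ℕ) (d : Fin m → Bool) : Set where
  field
    vtx  : Fin (suc m) → Vertex H
    step : ∀ (k : Fin m) → DirArc H (d k) (vtx (inject₁ k)) (vtx (fsuc k))

open Walk public

-- Two walks with the same direction pattern d are congruent; so congruent walks
-- are represented as two walks of type Walk H m d.
Avoid : {H : Digraph} {m : ℕ} {d : Fin m → Bool} → Walk H m d → Walk H m d → Set
Avoid {H} {m} {d} P Q =
  ∀ (k : Fin m) →
    ¬ (DirArc H (d k) (vtx P (inject₁ k)) (vtx Q (fsuc k)) ×
       DirArc H (d k) (vtx Q (inject₁ k)) (vtx P (fsuc k)))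

SymInvPair : (H : Digraph) → Vertex H → Vertex H → Set
SymInvPair H u v =
  ¬ (u ≡ v) ×
  ∃ λ (m : ℕ) → ∃ λ (d : Fin m → Bool) → ∃ λ (P : Walk H m d) → ∃ λ (Q : Walk H m d) →
    vtx P Data.Fin.zero ≡ u × vtx P (Data.Fin.fromℕ m) ≡ v ×
    vtx Q Data.Fin.zero ≡ v × vtx Q (Data.Fin.fromℕ m) ≡ u ×
    Avoid P Q

HasSymInvPair : Digraph → Set
HasSymInvPair H = ∃ λ u → ∃ λ v → SymInvPair H u v

-- The key observation is that two congruent
-- walks P = x₀…xₘ and Q = y₀…yₘ that avoid each other preserve the order
-- of their positions: if x₀ < y₀ then xₘ < yₘ.  It suffices to check one
-- step (`avoidingStep`): if x_k < y_k but not x_{k+1} < y_{k+1}, then either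
-- x_{k+1} = y_{k+1}, or y_{k+1} < x_{k+1} and the Min-Max property applied to
-- the two arcs of step k produces the crossing arcs; either way both faithful
-- arcs x_k y_{k+1} and y_k x_{k+1} exist, which avoidance forbids.
--
-- For a symmetrically invertible pair u, v with walks P : u ⇝ v, Q : v ⇝ u,
-- the claim turns u < v into v < u, so u < v is impossible
-- (`symInvPair-¬<`).  Being symmetrically invertible is symmetric in u and v
-- (`symInvPair-sym`), so v < u is impossible too, and u ≠ v rules out the
-- remaining case of trichotomy.
module Submission where

open import Defs
open import Data.Nat using (zero; suc)
open import Data.Fin using (fromℕ) renaming (zero to fzero; suc to fsuc)
open import Data.Bool using (true; false)
open import Data.Product using (_×_; _,_; proj₁; proj₂)
open import Data.Empty using (⊥-elim)
open import Relation.Nullary using (¬_)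
open import Relation.Binary.PropositionalEquality using (refl; sym; subst₂)
open import Relation.Binary.Structures using (IsStrictTotalOrder)
open import Relation.Binary.Definitions using (tri<; tri≈; tri>)

avoid-sym : ∀ {H m d} (P Q : Walk H m d) → Avoid P Q → Avoid Q P
avoid-sym P Q avoid k (qp , pq) = avoid k (pq , qp)

symInvPair-sym : ∀ {H u v} → SymInvPair H u v → SymInvPair H v u
symInvPair-sym (u≢v , m , d , P , Q , P₀ , Pₘ , Q₀ , Qₘ , avoid) =
  (λ v≡u → u≢v (sym v≡u)) , m , d , Q , P , Q₀ , Qₘ , P₀ , Pₘ , avoid-sym P Q avoid

dropFirst : ∀ {H m d} → Walk H (suc m) d → Walk H m (λ k → d (fsuc k))
dropFirst P = record { vtx = λ k → vtx P (fsuc k) ; step = λ k → step P (fsuc k) }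

module _ (H : Digraph) (_<_ : Vertex H → Vertex H → Set)
         (minMax : IsMinMaxOrdering H _<_) where

  open IsStrictTotalOrder (proj₁ minMax) using (compare; asym)

  exchange : ∀ i j s r → i < j → s < r → Arc H i r → Arc H j s →
             Arc H i s × Arc H j r
  exchange = proj₂ minMax

  avoidingStep : ∀ b {x₀ x₁ y₀ y₁} →
    DirArc H b x₀ x₁ → DirArc H b y₀ y₁ →
    ¬ (DirArc H b x₀ y₁ × DirArc H b y₀ x₁) → x₀ < y₀ → x₁ < y₁
  avoidingStep b {x₁ = x₁} {y₁ = y₁} x₀x₁ y₀y₁ notBoth x₀<y₀ with compare x₁ y₁
  ... | tri< x₁<y₁ _ _ = x₁<y₁
  ... | tri≈ _ refl _  = ⊥-elim (notBoth (x₀x₁ , y₀y₁))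
  avoidingStep true  {x₀} {x₁} {y₀} {y₁} x₀x₁ y₀y₁ notBoth x₀<y₀ | tri> _ _ y₁<x₁ =
    ⊥-elim (notBoth (exchange x₀ y₀ y₁ x₁ x₀<y₀ y₁<x₁ x₀x₁ y₀y₁))
  avoidingStep false {x₀} {x₁} {y₀} {y₁} x₁x₀ y₁y₀ notBoth x₀<y₀ | tri> _ _ y₁<x₁ =
    ⊥-elim (notBoth (exchange y₁ x₁ x₀ y₀ y₁<x₁ x₀<y₀ y₁y₀ x₁x₀))

  avoidingWalksPreserveOrder : ∀ m d (P Q : Walk H m d) → Avoid P Q →
    vtx P fzero < vtx Q fzero → vtx P (fromℕ m) < vtx Q (fromℕ m)
  avoidingWalksPreserveOrder zero    d P Q avoid x₀<y₀ = x₀<y₀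
  avoidingWalksPreserveOrder (suc m) d P Q avoid x₀<y₀ =
    avoidingWalksPreserveOrder m (λ k → d (fsuc k)) (dropFirst P) (dropFirst Q)
      (λ k → avoid (fsuc k))
      (avoidingStep (d fzero) (step P fzero) (step Q fzero) (avoid fzero) x₀<y₀)

  symInvPair-¬< : ∀ {u v} → SymInvPair H u v → ¬ (u < v)
  symInvPair-¬< (_ , m , d , P , Q , P₀ , Pₘ , Q₀ , Qₘ , avoid) u<v =
    asym u<v (subst₂ _<_ Pₘ Qₘ
      (avoidingWalksPreserveOrder m d P Q avoid (subst₂ _<_ (sym P₀) (sym Q₀) u<v)))

theorem2 : (H : Digraph) → HasSymInvPair H → ¬ AdmitsMinMaxOrdering H
theorem2 H (u , v , pair) (_<_ , minMax)
  with IsStrictTotalOrder.compare (proj₁ minMax) u v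
... | tri< u<v _ _ = symInvPair-¬< H _<_ minMax pair u<v
... | tri≈ _ u≡v _ = proj₁ pair u≡v
... | tri> _ _ v<u = symInvPair-¬< H _<_ minMax (symInvPair-sym pair) v<u
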